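{- Let $p$ be a prime and let $G=\Gamma(\mathbb{Z}_{p}[x]/\langle x^{4}\rangle)$ be the zero divisor graph of $\mathbb{Z}_{p}[x]/\langle x^{4}\rangle$. Let $d_{u}=p^{3}-2$, $d_{v}=p^{2}-2$ and $d_{w}=p-1$. For any function $\phi$ of two variables with $\phi(a,b)=\phi(b,a)$, the vertex-degree-based topological index $\phi(G)=\sum_{xy\in E(G)}\phi(d_{x},d_{y})$ (with $d_x$ the degree of $x$) equals \[ \binom{p-1}{2}\phi(d_{u},d_{u})+(p-1)(p^{2}-p)\,\phi(d_{u},d_{v})+\binom{p^{2}-p}{2}\phi(d_{v},d_{v})+(p^{3}-p^{2})(p-1)\,\phi(d_{u},d_{w}). \]
   Context: For a commutative ring $R$ with nonzero identity, the zero divisor graph $\Gamma(R)$ is the simple graph whose vertex set is the set of nonzero zero divisors of $R$, two distinct vertices $x,y$ being adjacent if and only if $x\cdot y=0$. (In $G$, the $p-1$ vertices $kx^{3}$, $k\neq 0$, have degree $p^{3}-2$; the $p^{2}-p$ vertices $bx^{2}+cx^{3}$ with $b\neq 0$ have degree $p^{2}-2$; the $p^{3}-p^{2}$ vertices $ax+bx^{2}+cx^{3}$ with $a\neq 0$ have degree $p-1$.) -}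

module Defs where

open import Data.Nat using (ℕ; zero; suc; _+_; _*_; NonZero)
open import Data.Nat.DivMod using (_mod_)
open import Data.Fin using (Fin; toℕ)
import Data.Fin.Properties as FinP
open import Data.Vec using (Vec; []; _∷_)
import Data.Vec.Properties as VecP
open import Data.List using (List; []; _∷_; _++_; map; concatMap; allFin; filter; length; foldr)
open import Data.Bool.ListAction using (any)
open import Data.Bool using (Bool; true; false; not; _∧_)
open import Data.Product using (_×_; _,_; proj₁; proj₂)
open import Relation.Nullary using (does; ¬_; Dec)
open import Relation.Nullary.Decidable using (⌊_⌋)
open import Relation.Binary.PropositionalEquality using (_≡_)
open import Algebra.Bundles using (CommutativeMonoid)

-- The ring  Z_p[x]/<x^4> : elements a0 + a1 x + a2 x^2 + a3 x^3  with ai ∈ Z_p,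
-- represented by the coefficient vector (a0 , a1 , a2 , a3).
R : ℕ → Set
R p = Vec (Fin p) 4

module _ (p : ℕ) .{{_ : NonZero p}} where

  _≟R_ : (a b : R p) → Dec (a ≡ b)
  _≟R_ = VecP.≡-dec FinP._≟_

  zeroR : R p
  zeroR = (0 mod p) ∷ (0 mod p) ∷ (0 mod p) ∷ (0 mod p) ∷ []

  -- truncated polynomial multiplication, coefficients reduced mod p
  mulR : R p → R p → R p
  mulR (a0 ∷ a1 ∷ a2 ∷ a3 ∷ []) (b0 ∷ b1 ∷ b2 ∷ b3 ∷ []) =
      ((n a0 * n b0) mod p)
    ∷ ((n a0 * n b1 + n a1 * n b0) mod p)
    ∷ ((n a0 * n b2 + n a1 * n b1 + n a2 * n b0) mod p)
    ∷ ((n a0 * n b3 + n a1 * n b2 + n a2 * n b1 + n a3 * n b0) mod p)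
    ∷ []
    where
    n : Fin p → ℕ
    n = toℕ

  allVecs : (k : ℕ) → List (Vec (Fin p) k)
  allVecs zero = [] ∷ []
  allVecs (suc k) = concatMap (λ a → map (a ∷_) (allVecs k)) (allFin p)

  elems : List (R p)
  elems = allVecs 4

  isZeroB : R p → Bool
  isZeroB a = ⌊ a ≟R zeroR ⌋

  isNZZD : R p → Bool
  isNZZD a = not (isZeroB a) ∧ any (λ b → not (isZeroB b) ∧ isZeroB (mulR a b)) elems

  vertices : List (R p)
  vertices = filter (λ a → Data.Bool._≟_ (isNZZD a) true) elems

  adjB : R p → R p → Bool
  adjB a b = not ⌊ a ≟R b ⌋ ∧ isZeroB (mulR a b)

  deg : R p → ℕ
  deg a = length (filter (λ b → Data.Bool._≟_ (adjB a b) true) vertices)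

  pairs : {A : Set} → List A → List (A × A)
  pairs [] = []
  pairs (x ∷ xs) = map (x ,_) xs ++ pairs xs

  edges : List (R p × R p)
  edges = filter (λ e → Data.Bool._≟_ (adjB (proj₁ e) (proj₂ e)) true) (pairs vertices)

  topIndex : ∀ {c ℓ} (M : CommutativeMonoid c ℓ) →
             (ℕ → ℕ → CommutativeMonoid.Carrier M) → CommutativeMonoid.Carrier M
  topIndex M φ = foldr (λ e acc → φ (deg (proj₁ e)) (deg (proj₂ e)) ∙ acc) ε edges
    where open CommutativeMonoid M

-- The nonzero zero divisors of ℤₚ[x]/⟨x⁴⟩ are the nonzero elements of the ideal (x): an element with nonzero
-- constant term annihilates no nonzero element, because ℤₚ has no zero divisors. Sorting the vertices by their lowest
-- nonzero term gives three classes, u (x³), v (x²) and w (x), of sizes p − 1, p² − p and p³ − p², and, again because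
-- p is prime, two vertices are adjacent exactly when the exponents of their lowest terms add up to at least 4. Hence
-- adjacency and degrees depend only on the classes, and the sum over edges becomes a sum over unordered pairs of
-- classes, weighted by the binomial and product counts of the class sizes.

module Submission where

open import Defs
open import Data.Nat using (ℕ; zero; suc; NonZero; _∸_; _^_; _*_)
open import Data.Nat.Primality using (Prime; ¬prime[0]; ¬prime[1])
open import Data.Nat.Combinatorics using (_C_)
open import Data.Empty using (⊥-elim)
open import Algebra.Bundles using (CommutativeMonoid)

module BoolCounting where

  open import Data.Nat using (ℕ; zero; suc; _+_)
  open import Data.Nat.Properties using (+-comm; +-identityʳ)
  open import Data.Bool using (Bool; true; false; not; _∧_; if_then_else_; _≟_)
  open import Data.Bool.Properties using (∨-zeroʳ)
  open import Data.Bool.ListAction using (any)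
  open import Data.Fin using (Fin)
  import Data.Fin as Fin
  open import Data.List using (List; []; _∷_; _++_; map; filter; length; tabulate)
  open import Data.List.Relation.Unary.All using (All; []; _∷_)
  open import Data.List.Relation.Unary.AllPairs using (AllPairs; _∷_)
  open import Data.List.Relation.Unary.Any using (here; there)
  open import Data.List.Membership.Propositional using (_∈_)
  import Data.List.Relation.Unary.All as All
  open import Function using (_∘_)
  open import Relation.Binary.Definitions using (DecidableEquality)
  open import Relation.Binary.PropositionalEquality using (_≡_; _≢_; refl; cong; trans)
  open import Relation.Nullary using (yes; no)
  open import Relation.Nullary.Decidable using (isYes)

  keep : {A : Set} → (A → Bool) → List A → List A
  keep f = filter (λ a → f a ≟ true)

  countᵇ : {A : Set} → (A → Bool) → List A → ℕ
  countᵇ f [] = 0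
  countᵇ f (x ∷ xs) = if f x then suc (countᵇ f xs) else countᵇ f xs

  module _ {A : Set} where

    length-keep : (f : A → Bool) (xs : List A) → length (keep f xs) ≡ countᵇ f xs
    length-keep f [] = refl
    length-keep f (x ∷ xs) with f x
    ... | true  = cong suc (length-keep f xs)
    ... | false = length-keep f xs

    keep-cong : {f g : A → Bool} → (∀ x → f x ≡ g x) → (xs : List A) → keep f xs ≡ keep g xs
    keep-cong f≗g [] = refl
    keep-cong {f} {g} f≗g (x ∷ xs) with f x | g x | f≗g x
    ... | true  | true  | refl = cong (x ∷_) (keep-cong f≗g xs)
    ... | false | false | refl = keep-cong f≗g xs

    All-keep : (f : A → Bool) (xs : List A) → All (λ x → f x ≡ true) (keep f xs)
    All-keep f [] = []
    All-keep f (x ∷ xs) with f x in fx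
    ... | true  = fx ∷ All-keep f xs
    ... | false = All-keep f xs

    countᵇ-keep : (f g : A → Bool) (xs : List A) → countᵇ g (keep f xs) ≡ countᵇ (λ x → f x ∧ g x) xs
    countᵇ-keep f g [] = refl
    countᵇ-keep f g (x ∷ xs) with f x
    ... | false = countᵇ-keep f g xs
    ... | true with g x
    ...   | true  = cong suc (countᵇ-keep f g xs)
    ...   | false = countᵇ-keep f g xs

    countᵇ-++ : (f : A → Bool) (xs ys : List A) → countᵇ f (xs ++ ys) ≡ countᵇ f xs + countᵇ f ys
    countᵇ-++ f [] ys = refl
    countᵇ-++ f (x ∷ xs) ys with f x
    ... | true  = cong suc (countᵇ-++ f xs ys)
    ... | false = countᵇ-++ f xs ys

    countᵇ-map : {B : Set} (f : B → Bool) (g : A → B) (xs : List A) → countᵇ f (map g xs) ≡ countᵇ (f ∘ g) xs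
    countᵇ-map f g [] = refl
    countᵇ-map f g (x ∷ xs) with f (g x)
    ... | true  = cong suc (countᵇ-map f g xs)
    ... | false = countᵇ-map f g xs

    countᵇ-cong : {f g : A → Bool} {xs : List A} → All (λ x → f x ≡ g x) xs → countᵇ f xs ≡ countᵇ g xs
    countᵇ-cong [] = refl
    countᵇ-cong {f} {g} {x ∷ xs} (fx≡gx ∷ rest) with f x | g x | fx≡gx
    ... | true  | true  | refl = cong suc (countᵇ-cong rest)
    ... | false | false | refl = countᵇ-cong rest

    countᵇ-false : (xs : List A) → countᵇ (λ _ → false) xs ≡ 0
    countᵇ-false [] = refl
    countᵇ-false (x ∷ xs) = countᵇ-false xs

    countᵇ-tabulate : ∀ m (f : A → Bool) (g : Fin m → A) b → (∀ i → f (g i) ≡ b) →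
                      countᵇ f (tabulate g) ≡ (if b then m else 0)
    countᵇ-tabulate zero f g true  _ = refl
    countᵇ-tabulate zero f g false _ = refl
    countᵇ-tabulate (suc m) f g b fg≡b with f (g Fin.zero) | fg≡b Fin.zero
    ... | true  | refl = cong suc (countᵇ-tabulate m f (g ∘ Fin.suc) true (fg≡b ∘ Fin.suc))
    ... | false | refl = countᵇ-tabulate m f (g ∘ Fin.suc) false (fg≡b ∘ Fin.suc)

    any-∈ : (f : A → Bool) {x : A} {xs : List A} → x ∈ xs → f x ≡ true → any f xs ≡ true
    any-∈ f (here refl) fx rewrite fx = refl
    any-∈ f {xs = y ∷ ys} (there x∈ys) fx rewrite any-∈ f x∈ys fx = ∨-zeroʳ (f y)

    any-false : (f : A → Bool) → (∀ x → f x ≡ false) → (xs : List A) → any f xs ≡ false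
    any-false f f≗false [] = refl
    any-false f f≗false (x ∷ xs) rewrite f≗false x = any-false f f≗false xs

    module _ (_≟A_ : DecidableEquality A) (f : A → Bool) (x : A) where

      countᵇ-≢-∉ : (xs : List A) → All (x ≢_) xs →
                   countᵇ (λ y → not (isYes (x ≟A y)) ∧ f y) xs ≡ countᵇ f xs
      countᵇ-≢-∉ [] [] = refl
      countᵇ-≢-∉ (y ∷ xs) (x≢y ∷ x∉xs) with x ≟A y
      ... | yes x≡y = ⊥-elim (x≢y x≡y)
      ... | no _ with f y
      ...   | true  = cong suc (countᵇ-≢-∉ xs x∉xs)
      ...   | false = countᵇ-≢-∉ xs x∉xs

      countᵇ-≢-∈ : (xs : List A) → AllPairs _≢_ xs → x ∈ xs →
                   countᵇ (λ y → not (isYes (x ≟A y)) ∧ f y) xs + (if f x then 1 else 0) ≡ countᵇ f xs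
      countᵇ-≢-∈ (y ∷ xs) (x∉xs ∷ _) (here refl) with x ≟A x
      ... | no x≢x = ⊥-elim (x≢x refl)
      ... | yes _ with f x
      ...   | true  = trans (+-comm _ 1) (cong suc (countᵇ-≢-∉ xs x∉xs))
      ...   | false = trans (+-identityʳ _) (countᵇ-≢-∉ xs x∉xs)
      countᵇ-≢-∈ (y ∷ xs) (y∉xs ∷ unique) (there x∈xs) with x ≟A y
      ... | yes refl = ⊥-elim (All.lookup y∉xs x∈xs refl)
      ... | no _ with f y
      ...   | true  = cong suc (countᵇ-≢-∈ xs unique x∈xs)
      ...   | false = countᵇ-≢-∈ xs unique x∈xs

module ListSum {c ℓ} (M : CommutativeMonoid c ℓ) where

  open CommutativeMonoid M
  open import Data.Bool using (Bool; true; false; if_then_else_)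
  open import Data.List using (List; []; _∷_; _++_; map; foldr)
  open import Data.List.Relation.Unary.All using (All; []; _∷_)
  open import Function using (_∘_)
  open import Relation.Binary.PropositionalEquality as ≡ using (_≡_)
  open BoolCounting using (keep)

  sumOver : {A : Set} → List A → (A → Carrier) → Carrier
  sumOver xs f = foldr (λ x s → f x ∙ s) ε xs

  module _ {A : Set} where

    sumOver-++ : (xs ys : List A) (f : A → Carrier) → sumOver (xs ++ ys) f ≈ sumOver xs f ∙ sumOver ys f
    sumOver-++ [] ys f = sym (identityˡ _)
    sumOver-++ (x ∷ xs) ys f = trans (∙-congˡ (sumOver-++ xs ys f)) (sym (assoc _ _ _))

    sumOver-map : {B : Set} (g : A → B) (xs : List A) (f : B → Carrier) → sumOver (map g xs) f ≡ sumOver xs (f ∘ g)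
    sumOver-map g [] f = ≡.refl
    sumOver-map g (x ∷ xs) f = ≡.cong (f (g x) ∙_) (sumOver-map g xs f)

    sumOver-cong : {xs : List A} {f g : A → Carrier} → All (λ x → f x ≈ g x) xs → sumOver xs f ≈ sumOver xs g
    sumOver-cong [] = refl
    sumOver-cong (fx≈gx ∷ rest) = ∙-cong fx≈gx (sumOver-cong rest)

    sumOver-keep : (h : A → Bool) (xs : List A) (f : A → Carrier) →
                   sumOver (keep h xs) f ≈ sumOver xs (λ x → if h x then f x else ε)
    sumOver-keep h [] f = refl
    sumOver-keep h (x ∷ xs) f with h x
    ... | true  = ∙-congˡ (sumOver-keep h xs f)
    ... | false = trans (sumOver-keep h xs f) (sym (identityˡ _))

module UnorderedPairs where

  open import Data.List using (List; []; _∷_; _++_; map)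
  open import Data.List.Properties using (map-∘; map-++)
  open import Data.List.Relation.Unary.All using (All; []; _∷_)
  open import Data.List.Relation.Unary.AllPairs using (AllPairs; []; _∷_)
  import Data.List.Relation.Unary.All.Properties as All
  open import Data.Product using (_×_; _,_; proj₁; proj₂)
  open import Relation.Binary.PropositionalEquality using (_≡_; _≢_; refl; sym; trans; cong₂; module ≡-Reasoning)

  unorderedPairs : {A : Set} → List A → List (A × A)
  unorderedPairs [] = []
  unorderedPairs (x ∷ xs) = map (x ,_) xs ++ unorderedPairs xs

  unorderedPairs-map : {A B : Set} (g : A → B) (xs : List A) →
    unorderedPairs (map g xs) ≡ map (λ e → g (proj₁ e) , g (proj₂ e)) (unorderedPairs xs)
  unorderedPairs-map g [] = refl
  unorderedPairs-map g (x ∷ xs) = begin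
      map (g x ,_) (map g xs) ++ unorderedPairs (map g xs)
    ≡⟨ cong₂ _++_ (trans (sym (map-∘ xs)) (map-∘ xs)) (unorderedPairs-map g xs) ⟩
      map g×g (map (x ,_) xs) ++ map g×g (unorderedPairs xs)
    ≡⟨ sym (map-++ g×g (map (x ,_) xs) (unorderedPairs xs)) ⟩
      map g×g (map (x ,_) xs ++ unorderedPairs xs)
    ∎
    where
    open ≡-Reasoning
    g×g = λ (e : _ × _) → g (proj₁ e) , g (proj₂ e)

  All-unorderedPairs : {A : Set} {P : A → Set} {xs : List A} → All P xs → AllPairs _≢_ xs →
    All (λ e → P (proj₁ e) × P (proj₂ e) × proj₁ e ≢ proj₂ e) (unorderedPairs xs)
  All-unorderedPairs [] [] = []
  All-unorderedPairs (px ∷ pxs) (x∉xs ∷ unique) =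
    All.++⁺ (All.map⁺ (withHead pxs x∉xs)) (All-unorderedPairs pxs unique)
    where
    withHead : ∀ {ys} → All _ ys → All _ ys → All _ ys
    withHead [] [] = []
    withHead (py ∷ pys) (x≢y ∷ x∉ys) = (px , py , x≢y) ∷ withHead pys x∉ys

module VertexClasses where

  open import Data.Nat using (ℕ; suc; _+_)
  open import Data.Nat.Properties using (+-suc)
  open import Data.Bool using (Bool; true; false; if_then_else_)
  open import Data.List using (List; []; _∷_)
  open import Relation.Binary.PropositionalEquality using (_≡_; refl; sym; trans; cong; cong₂)
  open BoolCounting using (countᵇ)

  data Class : Set where
    u v w : Class

  _==_ : Class → Class → Bool
  u == u = true
  v == v = true
  w == w = true
  _ == _ = false

  multiplicity : Class → List Class → ℕ
  multiplicity s = countᵇ (_== s)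

  if-0 : ∀ b → (if b then 0 else 0) ≡ 0
  if-0 true  = refl
  if-0 false = refl

  +-suc² : ∀ a b c → a + (b + suc c) ≡ suc (a + (b + c))
  +-suc² a b c = trans (cong (a +_) (+-suc b c)) (+-suc a (b + c))

  countᵇ-byClass : (f : Class → Bool) (cs : List Class) →
    countᵇ f cs ≡ (if f u then multiplicity u cs else 0)
                + ((if f v then multiplicity v cs else 0) + (if f w then multiplicity w cs else 0))
  countᵇ-byClass f [] = sym (cong₂ _+_ (if-0 (f u)) (cong₂ _+_ (if-0 (f v)) (if-0 (f w))))
  countᵇ-byClass f (u ∷ cs) with f u | countᵇ-byClass f cs
  ... | true  | ih = cong suc ih
  ... | false | ih = ih
  countᵇ-byClass f (v ∷ cs) with f v | countᵇ-byClass f cs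
  ... | true  | ih = trans (cong suc ih) (sym (+-suc _ _))
  ... | false | ih = ih
  countᵇ-byClass f (w ∷ cs) with f w | countᵇ-byClass f cs
  ... | true  | ih = trans (cong suc ih) (sym (+-suc² (if f u then multiplicity u cs else 0)
                                                         (if f v then multiplicity v cs else 0) _))
  ... | false | ih = ih

module ClassPairSum {c ℓ} (M : CommutativeMonoid c ℓ) where

  open import Data.Nat using (ℕ; suc; _+_; _*_)
  open import Data.Nat.Properties using (*-suc)
  open import Data.Nat.Combinatorics using (_C_; nC1≡n; nCk+nC[k+1]≡[n+1]C[k+1])
  open import Data.List using (List; []; _∷_; map)
  open import Data.Product using (_,_; uncurry)
  open import Relation.Binary.PropositionalEquality as ≡ using (_≡_)
  open CommutativeMonoid M
  open import Algebra.Properties.Monoid.Mult monoid using (×-homo-+; ×-congˡ; ×-congʳ) renaming (_×_ to _·_)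
  open import Algebra.Solver.CommutativeMonoid M using (solve; _⊜_; _⊕_)
  open ListSum M
  open UnorderedPairs
  open VertexClasses

  suc[n]C2 : ∀ n → suc n C 2 ≡ n + n C 2
  suc[n]C2 n = ≡.trans (≡.sym (nCk+nC[k+1]≡[n+1]C[k+1] n 1)) (≡.cong (_+ n C 2) (nC1≡n n))

  module _ (H : Class → Class → Carrier) (H-sym : ∀ s t → H s t ≈ H t s) where

    classPairSum : ℕ → ℕ → ℕ → Carrier
    classPairSum a b c = (a C 2) · H u u ∙ ((a * b) · H u v ∙ ((b C 2) · H v v
                       ∙ ((c * a) · H u w ∙ ((b * c) · H v w ∙ (c C 2) · H w w))))

    rowSum : Class → List Class → Carrier
    rowSum s cs = multiplicity u cs · H s u ∙ (multiplicity v cs · H s v ∙ multiplicity w cs · H s w)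

    sumOver-row : ∀ s cs → sumOver (map (s ,_) cs) (uncurry H) ≈ rowSum s cs
    sumOver-row s [] = trans (sym (identityˡ _)) (∙-congˡ (sym (identityˡ _)))
    sumOver-row s (u ∷ cs) = trans (∙-congˡ (sumOver-row s cs))
      (solve 4 (λ a x y z → (a ⊕ (x ⊕ (y ⊕ z))) ⊜ ((a ⊕ x) ⊕ (y ⊕ z))) refl _ _ _ _)
    sumOver-row s (v ∷ cs) = trans (∙-congˡ (sumOver-row s cs))
      (solve 4 (λ a x y z → (a ⊕ (x ⊕ (y ⊕ z))) ⊜ (x ⊕ ((a ⊕ y) ⊕ z))) refl _ _ _ _)
    sumOver-row s (w ∷ cs) = trans (∙-congˡ (sumOver-row s cs))
      (solve 4 (λ a x y z → (a ⊕ (x ⊕ (y ⊕ z))) ⊜ (x ⊕ (y ⊕ (a ⊕ z)))) refl _ _ _ _)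

    ·-split : ∀ {m} n k x → m ≡ n + k → m · x ≈ n · x ∙ k · x
    ·-split n k x m≡n+k = trans (×-congˡ m≡n+k) (×-homo-+ x n k)

    sumOver-unorderedPairs : ∀ cs → sumOver (unorderedPairs cs) (uncurry H)
                             ≈ classPairSum (multiplicity u cs) (multiplicity v cs) (multiplicity w cs)
    sumOver-unorderedPairs [] =
      sym (trans (identityˡ _) (trans (identityˡ _) (trans (identityˡ _) (trans (identityˡ _) (identityˡ _)))))
    sumOver-unorderedPairs (s ∷ cs) =
      trans (sumOver-++ (map (s ,_) cs) (unorderedPairs cs) (uncurry H))
            (trans (∙-cong (sumOver-row s cs) (sumOver-unorderedPairs cs)) (addRow s))
      where
      #u = multiplicity u cs
      #v = multiplicity v cs
      #w = multiplicity w cs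
      -- Adding one element of class s raises (s C 2) by the multiplicity of s and each product by the other factor.
      addRow : ∀ s → rowSum s cs ∙ classPairSum #u #v #w
                     ≈ classPairSum (multiplicity u (s ∷ cs)) (multiplicity v (s ∷ cs)) (multiplicity w (s ∷ cs))
      addRow u = sym (trans
        (∙-cong (·-split #u (#u C 2) _ (suc[n]C2 #u))
                (∙-cong (·-split #v (#u * #v) _ ≡.refl)
                        (∙-congˡ (∙-cong (·-split #w (#w * #u) _ (*-suc #w #u)) refl))))
        (solve 9 (λ a1 a2 b1 b2 b3 c1 c2 d e →
            ((a1 ⊕ a2) ⊕ ((b1 ⊕ b2) ⊕ (b3 ⊕ ((c1 ⊕ c2) ⊕ (d ⊕ e)))))
          ⊜ ((a1 ⊕ (b1 ⊕ c1)) ⊕ (a2 ⊕ (b2 ⊕ (b3 ⊕ (c2 ⊕ (d ⊕ e))))))) refl _ _ _ _ _ _ _ _ _))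
      addRow v = sym (trans
        (∙-congˡ (∙-cong (·-split #u (#u * #v) _ (*-suc #u #v))
                         (∙-cong (·-split #v (#v C 2) _ (suc[n]C2 #v))
                                 (∙-congˡ (∙-cong (·-split #w (#v * #w) _ ≡.refl) refl)))))
        (trans (solve 9 (λ a0 a1 a2 b1 b2 c0 c1 c2 e →
            (a0 ⊕ ((a1 ⊕ a2) ⊕ ((b1 ⊕ b2) ⊕ (c0 ⊕ ((c1 ⊕ c2) ⊕ e)))))
          ⊜ ((a1 ⊕ (b1 ⊕ c1)) ⊕ (a0 ⊕ (a2 ⊕ (b2 ⊕ (c0 ⊕ (c2 ⊕ e))))))) refl _ _ _ _ _ _ _ _ _)
          (∙-congʳ (∙-congʳ (×-congʳ #u (H-sym u v))))))
      addRow w = sym (trans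
        (∙-congˡ (∙-congˡ (∙-congˡ (∙-cong (·-split #u (#w * #u) _ ≡.refl)
                                            (∙-cong (·-split #v (#v * #w) _ (*-suc #v #w))
                                                    (·-split #w (#w C 2) _ (suc[n]C2 #w)))))))
        (trans (solve 9 (λ x1 x2 x3 y1 y2 z1 z2 w1 w2 →
            (x1 ⊕ (x2 ⊕ (x3 ⊕ ((y1 ⊕ y2) ⊕ ((z1 ⊕ z2) ⊕ (w1 ⊕ w2))))))
          ⊜ ((y1 ⊕ (z1 ⊕ w1)) ⊕ (x1 ⊕ (x2 ⊕ (x3 ⊕ (y2 ⊕ (z2 ⊕ w2))))))) refl _ _ _ _ _ _ _ _ _)
          (∙-congʳ (∙-cong (×-congʳ #u (H-sym u w)) (∙-congʳ (×-congʳ #v (H-sym v w)))))))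

module Enumeration (p : ℕ) .{{_ : NonZero p}} where

  open import Data.Nat using (_+_)
  open import Data.Bool using (Bool; true; false; _∧_)
  open import Data.Fin using (Fin)
  open import Data.Vec using (Vec; []; _∷_)
  open import Data.Vec.Properties using (∷-injectiveˡ; ∷-injectiveʳ)
  open import Data.List using (List; []; _∷_; map; concatMap; allFin)
  open import Data.List.Membership.Propositional using (_∈_; lose)
  open import Data.List.Membership.Propositional.Properties using (∈-concatMap⁺; ∈-allFin; ∈-map⁺)
  open import Data.List.Relation.Unary.Any using (here)
  open import Data.List.Relation.Unary.All using (All; []; universal)
  import Data.List.Relation.Unary.All.Properties as All
  open import Data.List.Relation.Unary.AllPairs using (AllPairs; []; _∷_)
  import Data.List.Relation.Unary.AllPairs as AllPairs
  import Data.List.Relation.Unary.AllPairs.Properties as AllPairs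
  open import Data.List.Relation.Unary.Unique.Propositional.Properties using (allFin⁺)
  open import Relation.Binary.PropositionalEquality using (_≡_; _≢_; refl; cong; cong₂; trans)
  open BoolCounting

  ∈-allVecs : ∀ k (xs : Vec (Fin p) k) → xs ∈ allVecs p k
  ∈-allVecs zero [] = here refl
  ∈-allVecs (suc k) (a ∷ xs) =
    ∈-concatMap⁺ (λ b → map (b ∷_) (allVecs p k)) (lose (∈-allFin a) (∈-map⁺ (a ∷_) (∈-allVecs k xs)))

  allVecs-unique : ∀ k → AllPairs _≢_ (allVecs p k)
  allVecs-unique zero = [] ∷ []
  allVecs-unique (suc k) =
    AllPairs.concat⁺
      (All.map⁺ (universal (λ a → AllPairs.map⁺ (AllPairs.map (λ xs≢ys eq → xs≢ys (∷-injectiveʳ eq))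
                                                               (allVecs-unique k)))
                           (allFin p)))
      (AllPairs.map⁺ (AllPairs.map differentHeads (allFin⁺ p)))
    where
    differentHeads : ∀ {a b} → a ≢ b →
                     All (λ xs → All (xs ≢_) (map (b ∷_) (allVecs p k))) (map (a ∷_) (allVecs p k))
    differentHeads a≢b =
      All.map⁺ (universal (λ _ → All.map⁺ (universal (λ _ eq → a≢b (∷-injectiveˡ eq)) (allVecs p k)))
                          (allVecs p k))

  coordinatewise : ∀ {k} → Vec (Fin p → Bool) k → Vec (Fin p) k → Bool
  coordinatewise [] [] = true
  coordinatewise (f ∷ fs) (a ∷ xs) = f a ∧ coordinatewise fs xs

  productOfCounts : ∀ {k} → Vec (Fin p → Bool) k → ℕ
  productOfCounts [] = 1
  productOfCounts (f ∷ fs) = countᵇ f (allFin p) * productOfCounts fs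

  countᵇ-prefixed : ∀ {k} (f : Fin p → Bool) (fs : Vec (Fin p → Bool) k) (xss : List (Vec (Fin p) k)) as →
    countᵇ (coordinatewise (f ∷ fs)) (concatMap (λ a → map (a ∷_) xss) as)
    ≡ countᵇ f as * countᵇ (coordinatewise fs) xss
  countᵇ-prefixed f fs xss [] = refl
  countᵇ-prefixed f fs xss (a ∷ as) =
    trans (countᵇ-++ (coordinatewise (f ∷ fs)) (map (a ∷_) xss) (concatMap (λ a → map (a ∷_) xss) as))
          (trans (cong₂ _+_ (countᵇ-map (coordinatewise (f ∷ fs)) (a ∷_) xss) (countᵇ-prefixed f fs xss as))
                 (addHead (f a) refl))
    where
    addHead : ∀ b → f a ≡ b →
      countᵇ (λ xs → f a ∧ coordinatewise fs xs) xss + countᵇ f as * countᵇ (coordinatewise fs) xss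
      ≡ countᵇ f (a ∷ as) * countᵇ (coordinatewise fs) xss
    addHead true  fa rewrite fa = refl
    addHead false fa rewrite fa = cong (_+ countᵇ f as * countᵇ (coordinatewise fs) xss) (countᵇ-false xss)

  countᵇ-allVecs : ∀ k (fs : Vec (Fin p → Bool) k) → countᵇ (coordinatewise fs) (allVecs p k) ≡ productOfCounts fs
  countᵇ-allVecs zero [] = refl
  countᵇ-allVecs (suc k) (f ∷ fs) =
    trans (countᵇ-prefixed f fs (allVecs p k) (allFin p)) (cong (countᵇ f (allFin p) *_) (countᵇ-allVecs k fs))

module ZeroDivisorGraph (n : ℕ) (p-prime : Prime (suc (suc n))) where

  open import Data.Nat using (_+_)
  open import Data.Nat.Properties using (*-zeroʳ; +-identityʳ; +-assoc; m+n∸n≡m)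
  open import Data.Nat.DivMod using (_mod_)
  open import Data.Nat.Divisibility using (_∣_; m%n≡0⇒n∣m; >⇒∤)
  open import Data.Nat.Primality using (euclidsLemma)
  open import Data.Fin using (Fin; zero; suc; toℕ)
  open import Data.Fin.Properties using (toℕ-fromℕ<; toℕ<n)
  open import Data.Vec using (Vec; []; _∷_; lookup)
  open import Data.Bool using (Bool; true; false; not; _∧_; _≟_; if_then_else_)
  open import Data.Bool.Properties using (∧-zeroʳ)
  open import Data.Bool.ListAction using (any)
  open import Data.List using (List; []; _∷_; _++_; map; allFin; length)
  open import Data.Sum using (inj₁; inj₂)
  open import Data.Product using (_×_; _,_; proj₁; proj₂; uncurry)
  open import Function using (_∘_)
  open import Relation.Nullary.Decidable using (isYes; isYes≗does; dec-true; dec-false)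
  open import Relation.Binary.PropositionalEquality using (_≡_; _≢_; refl; sym; trans; cong; cong₂; module ≡-Reasoning)
  open import Data.List.Membership.Propositional using (_∈_)
  import Data.List.Relation.Unary.All as All
  open import Data.List.Relation.Unary.AllPairs using (AllPairs)
  open import Data.List.Relation.Unary.Unique.Propositional.Properties using (filter⁺)
  open import Data.Nat.Solver using (module +-*-Solver)
  open +-*-Solver using (solve; _:+_; _:*_; _:^_; _:=_; con)
  open BoolCounting
  open UnorderedPairs
  open VertexClasses

  p : ℕ
  p = suc (suc n)

  open Enumeration p

  product-nonzero : ∀ (i j : Fin (suc n)) m → m ≡ toℕ (suc i) * toℕ (suc j) → m mod p ≢ zero
  product-nonzero i j m m≡ij m≡0 with euclidsLemma (toℕ (suc i)) (toℕ (suc j)) p-prime p∣ij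
    where
    p∣ij : p ∣ toℕ (suc i) * toℕ (suc j)
    p∣ij rewrite sym m≡ij = m%n≡0⇒n∣m m p (trans (sym (toℕ-fromℕ< _)) (cong toℕ m≡0))
  ... | inj₁ p∣i = >⇒∤ (toℕ<n (suc i)) p∣i
  ... | inj₂ p∣j = >⇒∤ (toℕ<n (suc j)) p∣j

  m+n*0≡m : ∀ m k → m + k * 0 ≡ m
  m+n*0≡m m k = trans (cong (m +_) (*-zeroʳ k)) (+-identityʳ m)

  isZero-≡ : ∀ a → a ≡ zeroR p → isZeroB p a ≡ true
  isZero-≡ a a≡0 = trans (isYes≗does (_≟R_ p a (zeroR p))) (dec-true (_≟R_ p a (zeroR p)) a≡0)

  isZero-≢ : ∀ a → a ≢ zeroR p → isZeroB p a ≡ false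
  isZero-≢ a a≢0 = trans (isYes≗does (_≟R_ p a (zeroR p))) (dec-false (_≟R_ p a (zeroR p)) a≢0)

  isZero-coefficient≢0 : ∀ a i → lookup a i ≢ zero → isZeroB p a ≡ false
  isZero-coefficient≢0 a i aᵢ≢0 =
    isZero-≢ a (λ a≡0 → aᵢ≢0 (trans (cong (λ b → lookup b i) a≡0) (lookup-zeroR i)))
    where
    lookup-zeroR : ∀ i → lookup (zeroR p) i ≡ zero
    lookup-zeroR zero = refl
    lookup-zeroR (suc zero) = refl
    lookup-zeroR (suc (suc zero)) = refl
    lookup-zeroR (suc (suc (suc zero))) = refl

  isZero-x²x³ : ∀ m k → m ≡ 0 → k ≡ 0 → isZeroB p (zero ∷ zero ∷ (m mod p) ∷ (k mod p) ∷ []) ≡ true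
  isZero-x²x³ .0 .0 refl refl = isZero-≡ _ refl

  mulR-ideal : ∀ a₁ a₂ a₃ b₁ b₂ b₃ →
    mulR p (zero ∷ a₁ ∷ a₂ ∷ a₃ ∷ []) (zero ∷ b₁ ∷ b₂ ∷ b₃ ∷ [])
    ≡ zero ∷ zero ∷ ((toℕ a₁ * toℕ b₁) mod p) ∷ ((toℕ a₁ * toℕ b₂ + toℕ a₂ * toℕ b₁) mod p) ∷ []
  mulR-ideal a₁ a₂ a₃ b₁ b₂ b₃
    rewrite *-zeroʳ (toℕ a₁) | *-zeroʳ (toℕ a₂) | *-zeroʳ (toℕ a₃)
          | +-identityʳ (toℕ a₁ * toℕ b₁) | +-identityʳ (toℕ a₁ * toℕ b₂ + toℕ a₂ * toℕ b₁) = refl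

  isZero-x²≢0 : ∀ m c → m mod p ≢ zero → isZeroB p (zero ∷ zero ∷ (m mod p) ∷ c ∷ []) ≡ false
  isZero-x²≢0 m c = isZero-coefficient≢0 _ (suc (suc zero))

  isZero-x³≢0 : ∀ c m → m mod p ≢ zero → isZeroB p (zero ∷ zero ∷ c ∷ (m mod p) ∷ []) ≡ false
  isZero-x³≢0 c m = isZero-coefficient≢0 _ (suc (suc (suc zero)))

  isVertex : R p → Bool
  isVertex (zero ∷ suc _ ∷ _ ∷ _ ∷ []) = true
  isVertex (zero ∷ zero ∷ suc _ ∷ _ ∷ []) = true
  isVertex (zero ∷ zero ∷ zero ∷ suc _ ∷ []) = true
  isVertex _ = false

  -- Non-vertices are sent to u; that value is never used.
  class : R p → Class
  class (zero ∷ suc _ ∷ _ ∷ _ ∷ []) = w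
  class (zero ∷ zero ∷ suc _ ∷ _ ∷ []) = v
  class _ = u

  adjacentClasses : Class → Class → Bool
  adjacentClasses u _ = true
  adjacentClasses v u = true
  adjacentClasses v v = true
  adjacentClasses w u = true
  adjacentClasses _ _ = false

  isZero-mulR : ∀ a b → isVertex a ≡ true → isVertex b ≡ true →
                isZeroB p (mulR p a b) ≡ adjacentClasses (class a) (class b)
  isZero-mulR (zero ∷ suc i ∷ a₂ ∷ a₃ ∷ []) (zero ∷ suc j ∷ b₂ ∷ b₃ ∷ []) _ _ =
    trans (cong (isZeroB p) (mulR-ideal (suc i) a₂ a₃ (suc j) b₂ b₃))
          (isZero-x²≢0 (toℕ (suc i) * toℕ (suc j)) _ (product-nonzero i j _ refl))
  isZero-mulR (zero ∷ suc i ∷ a₂ ∷ a₃ ∷ []) (zero ∷ zero ∷ suc j ∷ b₃ ∷ []) _ _ =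
    trans (cong (isZeroB p) (mulR-ideal (suc i) a₂ a₃ zero (suc j) b₃))
          (isZero-x³≢0 _ (toℕ (suc i) * toℕ (suc j) + toℕ a₂ * 0) (product-nonzero i j _ (m+n*0≡m _ (toℕ a₂))))
  isZero-mulR (zero ∷ suc i ∷ a₂ ∷ a₃ ∷ []) (zero ∷ zero ∷ zero ∷ suc j ∷ []) _ _ =
    trans (cong (isZeroB p) (mulR-ideal (suc i) a₂ a₃ zero zero (suc j)))
          (isZero-x²x³ _ _ (*-zeroʳ (toℕ (suc i))) (cong₂ _+_ (*-zeroʳ (toℕ (suc i))) (*-zeroʳ (toℕ a₂))))
  isZero-mulR (zero ∷ zero ∷ suc i ∷ a₃ ∷ []) (zero ∷ suc j ∷ b₂ ∷ b₃ ∷ []) _ _ =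
    trans (cong (isZeroB p) (mulR-ideal zero (suc i) a₃ (suc j) b₂ b₃))
          (isZero-x³≢0 _ (0 * toℕ b₂ + toℕ (suc i) * toℕ (suc j)) (product-nonzero i j _ refl))
  isZero-mulR (zero ∷ zero ∷ suc i ∷ a₃ ∷ []) (zero ∷ zero ∷ suc j ∷ b₃ ∷ []) _ _ =
    trans (cong (isZeroB p) (mulR-ideal zero (suc i) a₃ zero (suc j) b₃)) (isZero-x²x³ _ _ refl (*-zeroʳ (toℕ (suc i))))
  isZero-mulR (zero ∷ zero ∷ suc i ∷ a₃ ∷ []) (zero ∷ zero ∷ zero ∷ suc j ∷ []) _ _ =
    trans (cong (isZeroB p) (mulR-ideal zero (suc i) a₃ zero zero (suc j))) (isZero-x²x³ _ _ refl (*-zeroʳ (toℕ (suc i))))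
  isZero-mulR (zero ∷ zero ∷ zero ∷ suc i ∷ []) (zero ∷ b₁ ∷ b₂ ∷ b₃ ∷ []) _ _ =
    trans (cong (isZeroB p) (mulR-ideal zero zero (suc i) b₁ b₂ b₃)) (isZero-x²x³ _ _ refl refl)
  isZero-mulR (zero ∷ zero ∷ zero ∷ zero ∷ []) _ () _
  isZero-mulR (suc _ ∷ _ ∷ _ ∷ _ ∷ []) _ () _
  isZero-mulR (zero ∷ suc i ∷ _ ∷ _ ∷ []) (zero ∷ zero ∷ zero ∷ zero ∷ []) _ ()
  isZero-mulR (zero ∷ suc i ∷ _ ∷ _ ∷ []) (suc _ ∷ _ ∷ _ ∷ _ ∷ []) _ ()
  isZero-mulR (zero ∷ zero ∷ suc i ∷ _ ∷ []) (zero ∷ zero ∷ zero ∷ zero ∷ []) _ ()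
  isZero-mulR (zero ∷ zero ∷ suc i ∷ _ ∷ []) (suc _ ∷ _ ∷ _ ∷ _ ∷ []) _ ()

  x³ : R p
  x³ = zero ∷ zero ∷ zero ∷ suc zero ∷ []

  isNonzeroAnnihilator : R p → R p → Bool
  isNonzeroAnnihilator a b = not (isZeroB p b) ∧ isZeroB p (mulR p a b)

  isNZZD-ideal : ∀ a₁ a₂ a₃ → (zero ∷ a₁ ∷ a₂ ∷ a₃ ∷ []) ≢ zeroR p → isNZZD p (zero ∷ a₁ ∷ a₂ ∷ a₃ ∷ []) ≡ true
  isNZZD-ideal a₁ a₂ a₃ a≢0 =
    cong₂ _∧_ (cong not (isZero-≢ _ a≢0))
              (any-∈ (isNonzeroAnnihilator _) (∈-allVecs 4 x³) (cong₂ _∧_ (cong not (isZero-≢ x³ λ ())) a·x³≡0))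
    where
    a·x³≡0 : isZeroB p (mulR p (zero ∷ a₁ ∷ a₂ ∷ a₃ ∷ []) x³) ≡ true
    a·x³≡0 = trans (cong (isZeroB p) (mulR-ideal a₁ a₂ a₃ zero zero (suc zero)))
                   (isZero-x²x³ _ _ (*-zeroʳ (toℕ a₁)) (cong₂ _+_ (*-zeroʳ (toℕ a₁)) (*-zeroʳ (toℕ a₂))))

  -- The lowest nonzero coefficient of b, multiplied by the unit a₀, reappears unchanged in a · b.
  isNonzeroAnnihilator-unit : ∀ i a₁ a₂ a₃ b → isNonzeroAnnihilator (suc i ∷ a₁ ∷ a₂ ∷ a₃ ∷ []) b ≡ false
  isNonzeroAnnihilator-unit i a₁ a₂ a₃ b@(zero ∷ zero ∷ zero ∷ zero ∷ []) =
    cong (λ z → not z ∧ isZeroB p (mulR p (suc i ∷ a₁ ∷ a₂ ∷ a₃ ∷ []) b)) (isZero-≡ _ refl)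
  isNonzeroAnnihilator-unit i a₁ a₂ a₃ b@(suc j ∷ _ ∷ _ ∷ _ ∷ []) =
    trans (cong (not (isZeroB p b) ∧_) (isZero-coefficient≢0 _ zero (product-nonzero i j _ refl)))
          (∧-zeroʳ (not (isZeroB p b)))
  isNonzeroAnnihilator-unit i a₁ a₂ a₃ b@(zero ∷ suc j ∷ _ ∷ _ ∷ []) =
    trans (cong (not (isZeroB p b) ∧_) (isZero-coefficient≢0 _ (suc zero) (product-nonzero i j _ (m+n*0≡m _ (toℕ a₁)))))
          (∧-zeroʳ (not (isZeroB p b)))
  isNonzeroAnnihilator-unit i a₁ a₂ a₃ b@(zero ∷ zero ∷ suc j ∷ _ ∷ []) =
    trans (cong (not (isZeroB p b) ∧_) (isZero-coefficient≢0 _ (suc (suc zero)) (product-nonzero i j _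
            (trans (m+n*0≡m _ (toℕ a₂)) (m+n*0≡m _ (toℕ a₁))))))
          (∧-zeroʳ (not (isZeroB p b)))
  isNonzeroAnnihilator-unit i a₁ a₂ a₃ b@(zero ∷ zero ∷ zero ∷ suc j ∷ []) =
    trans (cong (not (isZeroB p b) ∧_) (isZero-coefficient≢0 _ (suc (suc (suc zero))) (product-nonzero i j _
            (trans (m+n*0≡m _ (toℕ a₃)) (trans (m+n*0≡m _ (toℕ a₂)) (m+n*0≡m _ (toℕ a₁)))))))
          (∧-zeroʳ (not (isZeroB p b)))

  isNZZD≡isVertex : ∀ a → isNZZD p a ≡ isVertex a
  isNZZD≡isVertex (zero ∷ suc i ∷ a₂ ∷ a₃ ∷ []) = isNZZD-ideal (suc i) a₂ a₃ λ ()
  isNZZD≡isVertex (zero ∷ zero ∷ suc i ∷ a₃ ∷ []) = isNZZD-ideal zero (suc i) a₃ λ ()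
  isNZZD≡isVertex (zero ∷ zero ∷ zero ∷ suc i ∷ []) = isNZZD-ideal zero zero (suc i) λ ()
  isNZZD≡isVertex a@(zero ∷ zero ∷ zero ∷ zero ∷ []) =
    cong (λ z → not z ∧ any (isNonzeroAnnihilator a) (elems p)) (isZero-≡ a refl)
  isNZZD≡isVertex a@(suc i ∷ a₁ ∷ a₂ ∷ a₃ ∷ []) =
    trans (cong (not (isZeroB p a) ∧_)
                (any-false (isNonzeroAnnihilator a) (isNonzeroAnnihilator-unit i a₁ a₂ a₃) (elems p)))
          (∧-zeroʳ (not (isZeroB p a)))

  zeroᵇ : Fin p → Bool
  zeroᵇ zero = true
  zeroᵇ (suc _) = false

  classPattern : Class → Vec (Fin p → Bool) 4
  classPattern u = zeroᵇ ∷ zeroᵇ ∷ zeroᵇ ∷ not ∘ zeroᵇ ∷ []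
  classPattern v = zeroᵇ ∷ zeroᵇ ∷ not ∘ zeroᵇ ∷ (λ _ → true) ∷ []
  classPattern w = zeroᵇ ∷ not ∘ zeroᵇ ∷ (λ _ → true) ∷ (λ _ → true) ∷ []

  isVertex∧class≡pattern : ∀ s a → (isVertex a ∧ (class a == s)) ≡ coordinatewise (classPattern s) a
  isVertex∧class≡pattern u (suc _ ∷ _ ∷ _ ∷ _ ∷ []) = refl
  isVertex∧class≡pattern u (zero ∷ suc _ ∷ _ ∷ _ ∷ []) = refl
  isVertex∧class≡pattern u (zero ∷ zero ∷ suc _ ∷ _ ∷ []) = refl
  isVertex∧class≡pattern u (zero ∷ zero ∷ zero ∷ suc _ ∷ []) = refl
  isVertex∧class≡pattern u (zero ∷ zero ∷ zero ∷ zero ∷ []) = refl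
  isVertex∧class≡pattern v (suc _ ∷ _ ∷ _ ∷ _ ∷ []) = refl
  isVertex∧class≡pattern v (zero ∷ suc _ ∷ _ ∷ _ ∷ []) = refl
  isVertex∧class≡pattern v (zero ∷ zero ∷ suc _ ∷ _ ∷ []) = refl
  isVertex∧class≡pattern v (zero ∷ zero ∷ zero ∷ suc _ ∷ []) = refl
  isVertex∧class≡pattern v (zero ∷ zero ∷ zero ∷ zero ∷ []) = refl
  isVertex∧class≡pattern w (suc _ ∷ _ ∷ _ ∷ _ ∷ []) = refl
  isVertex∧class≡pattern w (zero ∷ suc _ ∷ _ ∷ _ ∷ []) = refl
  isVertex∧class≡pattern w (zero ∷ zero ∷ suc _ ∷ _ ∷ []) = refl
  isVertex∧class≡pattern w (zero ∷ zero ∷ zero ∷ suc _ ∷ []) = refl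
  isVertex∧class≡pattern w (zero ∷ zero ∷ zero ∷ zero ∷ []) = refl

  vertexList : List (R p)
  vertexList = keep isVertex (elems p)

  vertices≡vertexList : vertices p ≡ vertexList
  vertices≡vertexList = keep-cong isNZZD≡isVertex (elems p)

  vertexList-unique : AllPairs _≢_ vertexList
  vertexList-unique = filter⁺ (λ a → isVertex a ≟ true) (allVecs-unique 4)

  isVertex-∈ : ∀ {a} → a ∈ vertexList → isVertex a ≡ true
  isVertex-∈ = All.lookup (All-keep isVertex (elems p))

  classes : List Class
  classes = map class vertexList

  pairs≡unorderedPairs : {A : Set} (xs : List A) → pairs p xs ≡ unorderedPairs xs
  pairs≡unorderedPairs [] = refl
  pairs≡unorderedPairs (x ∷ xs) = cong (map (x ,_) xs ++_) (pairs≡unorderedPairs xs)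

  multiplicity-classes : ∀ s → multiplicity s classes ≡ productOfCounts (classPattern s)
  multiplicity-classes s = begin
      countᵇ (_== s) (map class vertexList)
    ≡⟨ countᵇ-map (_== s) class vertexList ⟩
      countᵇ (λ a → class a == s) (keep isVertex (elems p))
    ≡⟨ countᵇ-keep isVertex (λ a → class a == s) (elems p) ⟩
      countᵇ (λ a → isVertex a ∧ (class a == s)) (elems p)
    ≡⟨ countᵇ-cong (All.universal (isVertex∧class≡pattern s) (elems p)) ⟩
      countᵇ (coordinatewise (classPattern s)) (elems p)
    ≡⟨ countᵇ-allVecs 4 (classPattern s) ⟩
      productOfCounts (classPattern s)
    ∎
    where open ≡-Reasoning

  countᵇ-zeroᵇ : countᵇ zeroᵇ (allFin p) ≡ 1
  countᵇ-zeroᵇ = cong suc (countᵇ-tabulate (suc n) zeroᵇ suc false λ _ → refl)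

  countᵇ-nonzero : countᵇ (not ∘ zeroᵇ) (allFin p) ≡ suc n
  countᵇ-nonzero = countᵇ-tabulate (suc n) (not ∘ zeroᵇ) suc true λ _ → refl

  countᵇ-any : countᵇ (λ _ → true) (allFin p) ≡ p
  countᵇ-any = cong suc (countᵇ-tabulate (suc n) (λ _ → true) suc true λ _ → refl)

  multiplicity-u : multiplicity u classes ≡ suc n
  multiplicity-u = trans (multiplicity-classes u)
             (trans (cong₂ (λ z nz → z * (z * (z * (nz * 1)))) countᵇ-zeroᵇ countᵇ-nonzero)
                    (solve 1 (λ m → con 1 :* (con 1 :* (con 1 :* (m :* con 1))) := m) refl (suc n)))

  multiplicity-v : multiplicity v classes ≡ suc n * p
  multiplicity-v = trans (multiplicity-classes v)
             (trans (cong₂ (λ z y → z * (z * y)) countᵇ-zeroᵇ (cong₂ (λ nz q → nz * (q * 1)) countᵇ-nonzero countᵇ-any))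
                    (solve 2 (λ m q → con 1 :* (con 1 :* (m :* (q :* con 1))) := m :* q) refl (suc n) p))

  multiplicity-w : multiplicity w classes ≡ suc n * (p * p)
  multiplicity-w = trans (multiplicity-classes w)
             (trans (cong₂ (λ z y → z * y) countᵇ-zeroᵇ (cong₂ (λ nz q → nz * (q * (q * 1))) countᵇ-nonzero countᵇ-any))
                    (solve 2 (λ m q → con 1 :* (m :* (q :* (q :* con 1))) := m :* (q :* q)) refl (suc n) p))

  p³≡ : p ^ 3 ≡ suc n + (suc n * p + suc n * (p * p)) + 1
  p³≡ = solve 1 (λ m → (con 2 :+ m) :^ 3
                    := (con 1 :+ m) :+ ((con 1 :+ m) :* (con 2 :+ m) :+ (con 1 :+ m) :* ((con 2 :+ m) :* (con 2 :+ m))) :+ con 1)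
                refl n

  p²≡ : p ^ 2 ≡ suc n + (suc n * p + 0) + 1
  p²≡ = solve 1 (λ m → (con 2 :+ m) :^ 2 := (con 1 :+ m) :+ ((con 1 :+ m) :* (con 2 :+ m) :+ con 0) :+ con 1) refl n

  p²∸p≡ : p ^ 2 ∸ p ≡ suc n * p
  p²∸p≡ = trans (cong (_∸ p) p²≡p[p-1]+p) (m+n∸n≡m (suc n * p) p)
    where
    p²≡p[p-1]+p : p ^ 2 ≡ suc n * p + p
    p²≡p[p-1]+p = solve 1 (λ m → (con 2 :+ m) :^ 2 := (con 1 :+ m) :* (con 2 :+ m) :+ (con 2 :+ m)) refl n

  p³∸p²≡ : p ^ 3 ∸ p ^ 2 ≡ suc n * (p * p)
  p³∸p²≡ = trans (cong (_∸ p ^ 2) p³≡p²[p-1]+p²) (m+n∸n≡m (suc n * (p * p)) (p ^ 2))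
    where
    p³≡p²[p-1]+p² : p ^ 3 ≡ suc n * (p * p) + p ^ 2
    p³≡p²[p-1]+p² = solve 1 (λ m → (con 2 :+ m) :^ 3
                                  := (con 1 :+ m) :* ((con 2 :+ m) :* (con 2 :+ m)) :+ (con 2 :+ m) :^ 2) refl n

  degree : Class → ℕ
  degree u = p ^ 3 ∸ 2
  degree v = p ^ 2 ∸ 2
  degree w = p ∸ 1

  d≡k∸2 : ∀ {d m k} → d + 1 ≡ m → k ≡ m + 1 → d ≡ k ∸ 2
  d≡k∸2 {d} refl refl = sym (trans (cong (_∸ 2) (+-assoc d 1 1)) (m+n∸n≡m d 2))

  degree-from-count : ∀ s d → d + (if adjacentClasses s s then 1 else 0) ≡ countᵇ (adjacentClasses s) classes →
                      d ≡ degree s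
  degree-from-count s d d+self≡count with trans d+self≡count (countᵇ-byClass (adjacentClasses s) classes)
  degree-from-count u d _ | d+1≡ = d≡k∸2 (trans d+1≡ (cong₂ _+_ multiplicity-u (cong₂ _+_ multiplicity-v multiplicity-w))) p³≡
  degree-from-count v d _ | d+1≡ = d≡k∸2 (trans d+1≡ (cong₂ _+_ multiplicity-u (cong (_+ 0) multiplicity-v))) p²≡
  degree-from-count w d _ | d+0≡ = trans (sym (+-identityʳ d)) (trans d+0≡ (trans (+-identityʳ _) multiplicity-u))

  deg+self≡count : ∀ a → a ∈ vertexList →
    deg p a + (if adjacentClasses (class a) (class a) then 1 else 0) ≡ countᵇ (adjacentClasses (class a)) classes
  deg+self≡count a a∈V = begin
      deg p a + self
    ≡⟨ cong (_+ self) deg≡ ⟩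
      countᵇ (λ b → not (isYes (_≟R_ p a b)) ∧ adjacentClasses (class a) (class b)) vertexList + self
    ≡⟨ countᵇ-≢-∈ (_≟R_ p) (adjacentClasses (class a) ∘ class) a vertexList vertexList-unique a∈V ⟩
      countᵇ (adjacentClasses (class a) ∘ class) vertexList
    ≡⟨ sym (countᵇ-map (adjacentClasses (class a)) class vertexList) ⟩
      countᵇ (adjacentClasses (class a)) classes
    ∎
    where
    open ≡-Reasoning
    self = if adjacentClasses (class a) (class a) then 1 else 0
    deg≡ : deg p a ≡ countᵇ (λ b → not (isYes (_≟R_ p a b)) ∧ adjacentClasses (class a) (class b)) vertexList
    deg≡ = trans (cong (λ vs → length (keep (adjB p a) vs)) vertices≡vertexList)
                 (trans (length-keep (adjB p a) vertexList)
                        (countᵇ-cong (All.tabulate λ {b} b∈V →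
                           cong (not (isYes (_≟R_ p a b)) ∧_) (isZero-mulR a b (isVertex-∈ a∈V) (isVertex-∈ b∈V)))))

  deg≡degree : ∀ a → a ∈ vertexList → deg p a ≡ degree (class a)
  deg≡degree a a∈V = degree-from-count (class a) (deg p a) (deg+self≡count a a∈V)

  module _ {c ℓ} (M : CommutativeMonoid c ℓ) (φ : ℕ → ℕ → CommutativeMonoid.Carrier M)
           (φ-sym : ∀ a b → CommutativeMonoid._≈_ M (φ a b) (φ b a)) where

    open CommutativeMonoid M using (Carrier; _≈_; _∙_; ε; setoid; monoid; identityˡ; identityʳ; ∙-congˡ; ∙-cong)
    module M = CommutativeMonoid M
    open import Algebra.Properties.Monoid.Mult monoid using () renaming (_×_ to _·_)
    open import Relation.Binary.Reasoning.Setoid setoid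
    open ListSum M
    open ClassPairSum M

    weightIf : Bool → ℕ → ℕ → Carrier
    weightIf b d d′ = if b then φ d d′ else ε

    weightIf-cong : ∀ {b b′ d₁ d₁′ d₂ d₂′} → b ≡ b′ → d₁ ≡ d₁′ → d₂ ≡ d₂′ →
                    weightIf b d₁ d₂ ≡ weightIf b′ d₁′ d₂′
    weightIf-cong refl refl refl = refl

    classWeight : Class → Class → Carrier
    classWeight s t = weightIf (adjacentClasses s t) (degree s) (degree t)

    classWeight-sym : ∀ s t → classWeight s t ≈ classWeight t s
    classWeight-sym u u = M.refl
    classWeight-sym u v = φ-sym _ _
    classWeight-sym u w = φ-sym _ _
    classWeight-sym v u = φ-sym _ _
    classWeight-sym v v = M.refl
    classWeight-sym v w = M.refl
    classWeight-sym w u = φ-sym _ _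
    classWeight-sym w v = M.refl
    classWeight-sym w w = M.refl

    edgeWeight : R p × R p → Carrier
    edgeWeight (a , b) = weightIf (adjB p a b) (deg p a) (deg p b)

    edgeWeight≡classWeight : ∀ a b → a ∈ vertexList → b ∈ vertexList → a ≢ b →
                             edgeWeight (a , b) ≡ classWeight (class a) (class b)
    edgeWeight≡classWeight a b a∈V b∈V a≢b =
      weightIf-cong (cong₂ _∧_ (cong not (trans (isYes≗does (_≟R_ p a b)) (dec-false (_≟R_ p a b) a≢b)))
                               (isZero-mulR a b (isVertex-∈ a∈V) (isVertex-∈ b∈V)))
                    (deg≡degree a a∈V) (deg≡degree b b∈V)

    topIndex≈classPairSum : topIndex p M φ ≈
      classPairSum classWeight classWeight-sym (multiplicity u classes) (multiplicity v classes) (multiplicity w classes)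
    topIndex≈classPairSum = begin
        topIndex p M φ
      ≈⟨ sumOver-keep (λ e → adjB p (proj₁ e) (proj₂ e)) (pairs p (vertices p)) _ ⟩
        sumOver (pairs p (vertices p)) edgeWeight
      ≡⟨ cong (λ es → sumOver es edgeWeight)
              (trans (pairs≡unorderedPairs (vertices p)) (cong unorderedPairs vertices≡vertexList)) ⟩
        sumOver (unorderedPairs vertexList) edgeWeight
      ≈⟨ sumOver-cong (All.map (λ { (a∈V , b∈V , a≢b) → M.reflexive (edgeWeight≡classWeight _ _ a∈V b∈V a≢b) })
                              (All-unorderedPairs (All.tabulate (λ a∈V → a∈V)) vertexList-unique)) ⟩
        sumOver (unorderedPairs vertexList) (λ e → classWeight (class (proj₁ e)) (class (proj₂ e)))
      ≡⟨ sym (trans (cong (λ es → sumOver es (uncurry classWeight)) (unorderedPairs-map class vertexList))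
                    (sumOver-map _ (unorderedPairs vertexList) (uncurry classWeight))) ⟩
        sumOver (unorderedPairs classes) (uncurry classWeight)
      ≈⟨ sumOver-unorderedPairs classWeight classWeight-sym classes ⟩
        classPairSum classWeight classWeight-sym (multiplicity u classes) (multiplicity v classes) (multiplicity w classes)
      ∎

    ·-ε : ∀ m → m · ε ≈ ε
    ·-ε zero = M.refl
    ·-ε (suc m) = M.trans (identityˡ _) (·-ε m)

    indexFormula : Carrier
    indexFormula = ((p ∸ 1) C 2) · φ (degree u) (degree u)
                 ∙ (((p ∸ 1) * (p ^ 2 ∸ p)) · φ (degree u) (degree v)
                 ∙ (((p ^ 2 ∸ p) C 2) · φ (degree v) (degree v)
                 ∙ ((p ^ 3 ∸ p ^ 2) * (p ∸ 1)) · φ (degree u) (degree w)))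

    -- Classes v and w are not adjacent to w, so the last two terms of the pair sum vanish.
    classPairSum≈indexFormula : ∀ {#u #v #w} → #u ≡ p ∸ 1 → #v ≡ p ^ 2 ∸ p → #w ≡ p ^ 3 ∸ p ^ 2 →
                                classPairSum classWeight classWeight-sym #u #v #w ≈ indexFormula
    classPairSum≈indexFormula {#v = #v} {#w} refl refl refl =
      ∙-congˡ (∙-congˡ (∙-congˡ (M.trans (∙-congˡ (M.trans (∙-cong (·-ε (#v * #w)) (·-ε (#w C 2))) (identityˡ ε)))
                                          (identityʳ _))))

    topIndex≈indexFormula : topIndex p M φ ≈ indexFormula
    topIndex≈indexFormula = M.trans topIndex≈classPairSum
      (classPairSum≈indexFormula multiplicity-u (trans multiplicity-v (sym p²∸p≡)) (trans multiplicity-w (sym p³∸p²≡)))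

open import Algebra.Definitions.RawMonoid using (_×_)

mainTheorem5 : ∀ {c ℓ} (p : ℕ) .{{_ : NonZero p}} → Prime p →
    (M : CommutativeMonoid c ℓ) →
    (φ : ℕ → ℕ → CommutativeMonoid.Carrier M) →
    (∀ a b → CommutativeMonoid._≈_ M (φ a b) (φ b a)) →
    let open CommutativeMonoid M
        du = p ^ 3 ∸ 2
        dv = p ^ 2 ∸ 2
        dw = p ∸ 1
        _·_ = _×_ rawMonoid
    in topIndex p M φ ≈
         (((p ∸ 1) C 2) · φ du du
         ∙ (((p ∸ 1) * (p ^ 2 ∸ p)) · φ du dv
         ∙ (((p ^ 2 ∸ p) C 2) · φ dv dv
         ∙ ((p ^ 3 ∸ p ^ 2) * (p ∸ 1)) · φ du dw)))
mainTheorem5 zero p-prime = ⊥-elim (¬prime[0] p-prime)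
mainTheorem5 (suc zero) p-prime = ⊥-elim (¬prime[1] p-prime)
mainTheorem5 (suc (suc n)) p-prime M φ φ-sym = ZeroDivisorGraph.topIndex≈indexFormula n p-prime M φ φ-sym
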